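{- Let $T$ be a tree on $\{1,\ldots,n\}$, let $O(T)$ be the set of orderings of $E(T)$, and $C(T)$ the set of cycles arising as products of the edge-transpositions over orderings in $O(T)$. For $\sigma\in O(T)$ let $c_\sigma$ be its product and $p_\sigma$ its associated partial order. Then the map $c_\sigma\mapsto p_\sigma$ is a well-defined bijection from $C(T)$ onto $P(T)=\{p_\sigma:\sigma\in O(T)\}$, and for each $\sigma\in O(T)$ the set of orderings $\tau\in O(T)$ with $c_\tau=c_\sigma$ is exactly the set of linear extensions $L(p_\sigma)$ (viewing orderings as linear orders on $E(T)$).
   Context: Each edge $\{i,j\}$ is regarded as the transposition $(i,j)$. An ordering $\sigma=e_1e_2\cdots e_{n-1}$ of $E(T)$ (each edge exactly once) is identified with the linear order $e_1<e_2<\cdots<e_{n-1}$ on $E(T)$. For a vertex $i$, the local suborder $\sigma|_i$ is the restriction of this linear order to the set of edges incident with $i$. The partial order $p_\sigma$ on $E(T)$ is the transitive closure of $\bigcup_{i=1}^n\sigma|_i$. $L(p)$ denotes the set of linear orders on $E(T)$ containing the partial order $p$. -}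

module Defs where

open import Data.Nat using (ℕ; suc)
open import Data.Fin using (Fin) renaming (_<_ to _<ᶠ_)
open import Data.Fin.Permutation using (Permutation; _⟨$⟩ʳ_; _⟨$⟩ˡ_)
import Data.Fin.Permutation.Components as PC
open import Data.List using (List; []; _∷_; map)
open import Data.List using (allFin) public
open import Data.Product using (_×_; _,_; proj₁; proj₂; ∃)
open import Data.Sum using (_⊎_)
open import Function using (id; _∘_)
open import Relation.Binary.PropositionalEquality using (_≡_; _≢_)
open import Relation.Binary.Construct.Closure.ReflexiveTransitive using (Star)
open import Relation.Binary.Construct.Closure.Transitive using (TransClosure)

-- A graph on vertex set Fin n (= {1,…,n}) with m edges, indexed by Fin m;
-- edge e has endpoints proj₁ (edge e) and proj₂ (edge e).
EdgeList : ℕ → ℕ → Set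
EdgeList n m = Fin m → Fin n × Fin n

Adjacent : ∀ {n m} → EdgeList n m → Fin n → Fin n → Set
Adjacent {m = m} T u v = ∃ λ (e : Fin m) → (T e ≡ (u , v)) ⊎ (T e ≡ (v , u))

-- A tree on {1,…,n} with n = suc m vertices: m = n - 1 edges, no loops,
-- and connected (connected with n - 1 edges ⇔ tree).
record IsTree {m : ℕ} (T : EdgeList (suc m) m) : Set where
  field
    loopless  : ∀ e → proj₁ (T e) ≢ proj₂ (T e)
    connected : ∀ u v → Star (Adjacent T) u v

-- An ordering of E(T): a bijection positions → edges; σ ⟨$⟩ʳ k is the edge
-- at position k (e_{k+1}), and σ ⟨$⟩ˡ e is the position of edge e.
Ordering : ℕ → Set
Ordering m = Permutation m m

_<[_]_ : ∀ {m} → Fin m → Ordering m → Fin m → Set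
e <[ σ ] f = (σ ⟨$⟩ˡ e) <ᶠ (σ ⟨$⟩ˡ f)

Incident : ∀ {n m} → EdgeList n m → Fin n → Fin m → Set
Incident T i e = proj₁ (T e) ≡ i ⊎ proj₂ (T e) ≡ i

Local : ∀ {n m} → EdgeList n m → Ordering m → Fin n → Fin m → Fin m → Set
Local T σ i e f = Incident T i e × Incident T i f × e <[ σ ] f

LocalUnion : ∀ {n m} → EdgeList n m → Ordering m → Fin m → Fin m → Set
LocalUnion {n} T σ e f = ∃ λ (i : Fin n) → Local T σ i e f

p : ∀ {n m} → EdgeList n m → Ordering m → Fin m → Fin m → Set
p T σ = TransClosure (LocalUnion T σ)

prodTransp : ∀ {n} → List (Fin n × Fin n) → Fin n → Fin n
prodTransp [] = id
prodTransp ((i , j) ∷ es) = PC.transpose i j ∘ prodTransp es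

c : ∀ {n m} → EdgeList n m → Ordering m → Fin n → Fin n
c T σ = prodTransp (map (T ∘ (σ ⟨$⟩ʳ_)) (allFin _))

_≐_ : ∀ {n} → (Fin n → Fin n) → (Fin n → Fin n) → Set
f ≐ g = ∀ x → f x ≡ g x

_≐ᵣ_ : ∀ {m} → (Fin m → Fin m → Set) → (Fin m → Fin m → Set) → Set
P ≐ᵣ Q = ∀ e f → (P e f → Q e f) × (Q e f → P e f)

InL : ∀ {m} → Ordering m → (Fin m → Fin m → Set) → Set
InL τ q = ∀ e f → q e f → e <[ τ ] f

-- Under c_σ = e₁ e₂ ⋯ e_{n-1} the rightmost transposition acts first, so a vertex y first
-- crosses its σ-latest edge, then the latest edge at the new vertex that precedes the one just
-- crossed, and so on. This walk only consults the local orders σ|_i, so orderings with the same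
-- local orders (equivalently p_σ = p_τ, or τ ∈ L(p_σ)) have the same product.
-- Conversely, the walk never reuses an edge, and in a tree two such trails with the same ends
-- coincide: a tree is connected with n - 1 edges, so every edge is a bridge. Hence if c_σ = c_τ,
-- the σ- and τ-walks of each vertex cross the same edges in the same order. Any edge g that
-- immediately precedes f in σ|_i is crossed right after f by a suitable σ-walk, so τ also puts
-- g before f; chaining such steps, τ extends every local order of σ.

module Submission where

open import Defs
open import Data.Bool using (if_then_else_)
open import Data.Empty using (⊥-elim)
open import Data.Fin using (Fin; toℕ; fromℕ<) renaming (zero to fz; suc to fs)
open import Data.Fin.Permutation using (_⟨$⟩ʳ_; _⟨$⟩ˡ_; inverseˡ; inverseʳ)
import Data.Fin.Permutation.Components as PC
open import Data.Fin.Properties using (_≟_; any?; toℕ<n; toℕ-injective; toℕ-fromℕ<; fromℕ<-toℕ)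
open import Data.Fin.Subset using (Subset; inside; outside; ⊤; ⁅_⁆; _∪_; ∣_∣; _⊆_)
  renaming (_∈_ to _∈ₛ_)
open import Data.Fin.Subset.Properties
  using (∣⊤∣≡n; ∣⁅x⁆∣≡1; p⊆q⇒∣p∣≤∣q∣; p⊆p∪q; q⊆p∪q; x∈⁅x⁆)
open import Data.List using (List; []; _∷_; _++_; tabulate; filter; length)
open import Data.List.Properties using (map-tabulate; length-tabulate; filter-notAll; ++-assoc)
open import Data.List.Membership.Propositional using (_∈_)
open import Data.List.Membership.Propositional.Properties using (∈-filter⁺; ∈-allFin)
import Data.List.Relation.Binary.Subset.Propositional as List
open import Data.List.Relation.Binary.Infix.Heterogeneous using (Infix; here; there; _++ⁱ_)
open import Data.List.Relation.Binary.Prefix.Heterogeneous using ([]; _∷_)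
open import Data.List.Relation.Unary.All as All using (All; []; _∷_)
open import Data.List.Relation.Unary.All.Properties using (anti-mono; ¬Any⇒All¬)
open import Data.List.Relation.Unary.Any as Any using (here; there)
open import Data.List.Relation.Unary.Unique.Propositional using (Unique; []; _∷_)
open import Data.Nat using (ℕ; zero; suc; _+_; _≤_; _<_; _<?_; z≤n; s≤s; _≤′_; ≤′-refl; ≤′-step)
open import Data.Nat.Properties
  using (≤-refl; ≤-trans; <-trans; <⇒≤; ≤-pred; ≤-reflexive; ≤-antisym; <-irrefl; <-asym;
         <-≤-trans; n≤1+n; ≤∧≢⇒<; m≤n⇒m<n∨m≡n; m<n⇒m<1+n; ≤⇒≤′; <-cmp;
         +-comm; +-suc; +-identityʳ; +-monoˡ-≤; +-monoʳ-≤; module ≤-Reasoning)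
open import Data.Product using (_×_; _,_; proj₁; proj₂; ∃; ∃₂; Σ)
open import Data.Sum using (_⊎_; inj₁; inj₂)
open import Data.Vec using ([]; _∷_) renaming (tabulate to tabulateᵥ)
open import Data.Vec.Properties using (lookup∘tabulate; []=⇒lookup; lookup⇒[]=)
open import Function using (id; _∘_; _⇔_; mk⇔; Equivalence)
open import Relation.Binary using (tri<; tri≈; tri>)
open import Relation.Binary.PropositionalEquality
  using (_≡_; _≢_; refl; sym; trans; cong; subst; ≢-sym)
open import Relation.Binary.Construct.Closure.ReflexiveTransitive as Star using (Star; ε; _◅_; _◅◅_)
open import Relation.Binary.Construct.Closure.Transitive as Plus using (TransClosure; [_]; _∷_)
open import Relation.Nullary using (¬_; Dec; yes; no; does)
open import Relation.Nullary.Decidable using (dec-true; ¬?; _⊎-dec_)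

TransClosure-map : ∀ {A : Set} {R S : A → A → Set} → (∀ {a b} → R a b → S a b) →
                   ∀ {a b} → TransClosure R a b → TransClosure S a b
TransClosure-map R⇒S [ r ] = [ R⇒S r ]
TransClosure-map R⇒S (r ∷ rs) = R⇒S r ∷ TransClosure-map R⇒S rs

swap : ∀ {n} → Fin n × Fin n → Fin n → Fin n
swap (i , j) = PC.transpose i j

module _ {n : ℕ} (q : Fin n × Fin n) where

  swap-matchˡ : swap q (proj₁ q) ≡ proj₂ q
  swap-matchˡ with proj₁ q ≟ proj₁ q
  ... | yes _ = refl
  ... | no i≢i = ⊥-elim (i≢i refl)

  swap-matchʳ : swap q (proj₂ q) ≡ proj₁ q
  swap-matchʳ with proj₂ q ≟ proj₁ q
  ... | yes j≡i = j≡i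
  ... | no _ with proj₂ q ≟ proj₂ q
  ...   | yes _ = refl
  ...   | no j≢j = ⊥-elim (j≢j refl)

  swap-other : ∀ {k} → k ≢ proj₁ q → k ≢ proj₂ q → swap q k ≡ k
  swap-other {k} k≢i k≢j with k ≟ proj₁ q
  ... | yes k≡i = ⊥-elim (k≢i k≡i)
  ... | no _ with k ≟ proj₂ q
  ...   | yes k≡j = ⊥-elim (k≢j k≡j)
  ...   | no _ = refl

  swap-involutive : ∀ k → swap q (swap q k) ≡ k
  swap-involutive k = by-cases (k ≟ proj₁ q) (k ≟ proj₂ q)
    where
    by-cases : Dec (k ≡ proj₁ q) → Dec (k ≡ proj₂ q) → swap q (swap q k) ≡ k
    by-cases (yes refl) _ = trans (cong (swap q) swap-matchˡ) swap-matchʳ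
    by-cases (no _) (yes refl) = trans (cong (swap q) swap-matchʳ) swap-matchˡ
    by-cases (no k≢i) (no k≢j) = trans (cong (swap q) (swap-other k≢i k≢j)) (swap-other k≢i k≢j)

prefixProduct : ∀ {n} → (ℕ → Fin n × Fin n) → ℕ → Fin n → Fin n
prefixProduct h zero = id
prefixProduct h (suc k) = prefixProduct h k ∘ swap (h k)

prefixProduct-suc : ∀ {n} (h : ℕ → Fin n × Fin n) k →
                    prefixProduct h (suc k) ≐ (swap (h 0) ∘ prefixProduct (h ∘ suc) k)
prefixProduct-suc h zero y = refl
prefixProduct-suc h (suc k) y = prefixProduct-suc h k (swap (h (suc k)) y)

prodTransp-tabulate : ∀ {n} j (g : Fin j → Fin n × Fin n) (h : ℕ → Fin n × Fin n) →
                      (∀ q → h (toℕ q) ≡ g q) → prodTransp (tabulate g) ≐ prefixProduct h j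
prodTransp-tabulate zero g h h≗g y = refl
prodTransp-tabulate (suc j) g h h≗g y
  rewrite prefixProduct-suc h j y | h≗g fz =
  cong (swap (g fz)) (prodTransp-tabulate j (g ∘ fs) (h ∘ suc) (h≗g ∘ fs) y)

∣p∪q∣≤∣p∣+∣q∣ : ∀ {n} (p q : Subset n) → ∣ p ∪ q ∣ ≤ ∣ p ∣ + ∣ q ∣
∣p∪q∣≤∣p∣+∣q∣ [] [] = z≤n
∣p∪q∣≤∣p∣+∣q∣ (outside ∷ p) (outside ∷ q) = ∣p∪q∣≤∣p∣+∣q∣ p q
∣p∪q∣≤∣p∣+∣q∣ (outside ∷ p) (inside ∷ q) =
  subst (suc ∣ p ∪ q ∣ ≤_) (sym (+-suc ∣ p ∣ ∣ q ∣)) (s≤s (∣p∪q∣≤∣p∣+∣q∣ p q))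
∣p∪q∣≤∣p∣+∣q∣ (inside ∷ p) (outside ∷ q) = s≤s (∣p∪q∣≤∣p∣+∣q∣ p q)
∣p∪q∣≤∣p∣+∣q∣ (inside ∷ p) (inside ∷ q) =
  s≤s (≤-trans (∣p∪q∣≤∣p∣+∣q∣ p q) (+-monoʳ-≤ ∣ p ∣ (n≤1+n ∣ q ∣)))

image : ∀ {n k} → (Fin n → Fin k) → Subset k
image f = tabulateᵥ λ y → does (any? λ x → f x ≟ y)

module _ {n k} (f : Fin n → Fin k) where

  ∈-image⁺ : ∀ x → f x ∈ₛ image f
  ∈-image⁺ x = lookup⇒[]= (f x) (image f)
    (trans (lookup∘tabulate _ (f x)) (dec-true (any? λ x′ → f x′ ≟ f x) (x , refl)))

  ∈-image⁻ : ∀ {y} → y ∈ₛ image f → ∃ λ x → f x ≡ y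
  ∈-image⁻ {y} y∈ with any? (λ x → f x ≟ y) | trans (sym (lookup∘tabulate _ y)) ([]=⇒lookup y∈)
  ... | yes x,fx≡y | _ = x,fx≡y
  ... | no _ | ()

  ∣image∣≤1 : (∀ x x′ → f x ≡ f x′) → ∀ x₀ → ∣ image f ∣ ≤ 1
  ∣image∣≤1 const x₀ = subst (∣ image f ∣ ≤_) (∣⁅x⁆∣≡1 (f x₀)) (p⊆q⇒∣p∣≤∣q∣ image⊆)
    where
    image⊆ : image f ⊆ ⁅ f x₀ ⁆
    image⊆ y∈ with ∈-image⁻ y∈
    ... | x , refl = subst (_∈ₛ ⁅ f x₀ ⁆) (const x₀ x) (x∈⁅x⁆ (f x₀))

n≤∣image-id∣ : ∀ n → n ≤ ∣ image (id {A = Fin n}) ∣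
n≤∣image-id∣ n = subst (_≤ ∣ image id′ ∣) (∣⊤∣≡n n) (p⊆q⇒∣p∣≤∣q∣ {p = ⊤} λ {y} _ → ∈-image⁺ id′ y)
  where
  id′ : Fin n → Fin n
  id′ = id

-- Walks

module _ {m : ℕ} (T : EdgeList (suc m) m) where

  V : Set
  V = Fin (suc m)

  Inc : V → Fin m → Set
  Inc = Incident T

  sw : Fin m → V → V
  sw e = swap (T e)

  incident? : ∀ y e → Dec (Inc y e)
  incident? y e = (proj₁ (T e) ≟ y) ⊎-dec (proj₂ (T e) ≟ y)

  sw-incident : ∀ {y e} → Inc y e → Inc (sw e y) e
  sw-incident {e = e} (inj₁ refl) = inj₂ (sym (swap-matchˡ (T e)))
  sw-incident {e = e} (inj₂ refl) = inj₁ (sym (swap-matchʳ (T e)))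

  sw-nonincident : ∀ {y e} → ¬ Inc y e → sw e y ≡ y
  sw-nonincident {e = e} ¬i = swap-other (T e) (¬i ∘ inj₁ ∘ sym) (¬i ∘ inj₂ ∘ sym)

  sw-involutive : ∀ e y → sw e (sw e y) ≡ y
  sw-involutive e = swap-involutive (T e)

  incident-ends : ∀ {x e} → Inc x e → T e ≡ (x , sw e x) ⊎ T e ≡ (sw e x , x)
  incident-ends {e = e} (inj₁ refl) = inj₁ (cong (proj₁ (T e) ,_) (sym (swap-matchˡ (T e))))
  incident-ends {e = e} (inj₂ refl) = inj₂ (cong (_, proj₂ (T e)) (sym (swap-matchʳ (T e))))

  incident-endpoints : ∀ {x w e} → Inc x e → Inc w e → w ≡ x ⊎ w ≡ sw e x
  incident-endpoints (inj₁ refl) (inj₁ refl) = inj₁ refl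
  incident-endpoints {e = e} (inj₁ refl) (inj₂ refl) = inj₂ (sym (swap-matchˡ (T e)))
  incident-endpoints {e = e} (inj₂ refl) (inj₁ refl) = inj₂ (sym (swap-matchʳ (T e)))
  incident-endpoints (inj₂ refl) (inj₂ refl) = inj₁ refl

  pos : Ordering m → Fin m → ℕ
  pos σ e = toℕ (σ ⟨$⟩ˡ e)

  pos<m : ∀ σ e → pos σ e < m
  pos<m σ e = toℕ<n (σ ⟨$⟩ˡ e)

  pos-injective : ∀ σ {e f} → pos σ e ≡ pos σ f → e ≡ f
  pos-injective σ eq = trans (sym (inverseʳ σ)) (trans (cong (σ ⟨$⟩ʳ_) (toℕ-injective eq)) (inverseʳ σ))

  edgeAt : Ordering m → ∀ k → k < m → Fin m
  edgeAt σ k k<m = σ ⟨$⟩ʳ fromℕ< k<m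

  pos-edgeAt : ∀ σ k (k<m : k < m) → pos σ (edgeAt σ k k<m) ≡ k
  pos-edgeAt σ k k<m = trans (cong toℕ (inverseˡ σ)) (toℕ-fromℕ< k<m)

  -- Positions k ≥ m are never used; the junk value is the identity transposition.
  transpositionAt : Ordering m → ℕ → V × V
  transpositionAt σ k with k <? m
  ... | yes k<m = T (edgeAt σ k k<m)
  ... | no _ = fz , fz

  transpositionAt-< : ∀ σ k (k<m : k < m) → transpositionAt σ k ≡ T (edgeAt σ k k<m)
  transpositionAt-< σ k k<m with k <? m
  ... | yes _ = refl
  ... | no k≮m = ⊥-elim (k≮m k<m)

  prefix : Ordering m → ℕ → V → V
  prefix σ = prefixProduct (transpositionAt σ)

  c≐prefix : ∀ σ → c T σ ≐ prefix σ m
  c≐prefix σ y rewrite map-tabulate id (T ∘ (σ ⟨$⟩ʳ_)) =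
    prodTransp-tabulate m (T ∘ (σ ⟨$⟩ʳ_)) (transpositionAt σ) at-toℕ y
    where
    at-toℕ : ∀ q → transpositionAt σ (toℕ q) ≡ T (σ ⟨$⟩ʳ q)
    at-toℕ q = trans (transpositionAt-< σ (toℕ q) (toℕ<n q))
                     (cong (λ r → T (σ ⟨$⟩ʳ r)) (fromℕ<-toℕ q (toℕ<n q)))

  record LatestBelow (σ : Ordering m) (y : V) (k : ℕ) (f : Fin m) : Set where
    constructor latest
    field
      incident : Inc y f
      below    : pos σ f < k
      maximal  : ∀ f′ → Inc y f′ → pos σ f′ < k → pos σ f′ ≤ pos σ f
  open LatestBelow

  NoneBelow : Ordering m → V → ℕ → Set
  NoneBelow σ y k = ∀ f → Inc y f → ¬ pos σ f < k

  latest-unique : ∀ {σ y k f f′} → LatestBelow σ y k f → LatestBelow σ y k f′ → f ≡ f′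
  latest-unique {σ} l l′ =
    pos-injective σ (≤-antisym (maximal l′ _ (incident l) (below l)) (maximal l _ (incident l′) (below l′)))

  -- The journey of y under c_σ, using only the edges at positions below k, ends at z.
  data Walk (σ : Ordering m) : V → ℕ → V → Set where
    stop : ∀ {y k} → NoneBelow σ y k → Walk σ y k y
    step : ∀ {y k z} f → LatestBelow σ y k f → Walk σ (sw f y) (pos σ f) z → Walk σ y k z

  castWalk : ∀ {σ y y′ k k′ z} → y ≡ y′ → k ≡ k′ → Walk σ y k z → Walk σ y′ k′ z
  castWalk refl refl w = w

  edges : ∀ {σ y k z} → Walk σ y k z → List (Fin m)
  edges (stop _) = []
  edges (step f _ w) = f ∷ edges w

  castWalk-edges : ∀ {σ y y′ k k′ z} (p : y ≡ y′) (q : k ≡ k′) (w : Walk σ y k z) →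
                   edges (castWalk p q w) ≡ edges w
  castWalk-edges refl refl w = refl

  widen : ∀ {σ y k z} → Walk σ y k z → (∀ f → Inc y f → pos σ f ≢ k) → Walk σ y (suc k) z
  widen (stop none) ≢k = stop λ f i lt → none f i (≤∧≢⇒< (≤-pred lt) (≢k f i))
  widen (step f (latest i lt mx) w) ≢k =
    step f (latest i (m<n⇒m<1+n lt) λ f′ i′ lt′ → mx f′ i′ (≤∧≢⇒< (≤-pred lt′) (≢k f′ i′))) w

  widen-edges : ∀ {σ y k z} (w : Walk σ y k z) ≢k → edges (widen w ≢k) ≡ edges w
  widen-edges (stop _) _ = refl
  widen-edges (step _ _ _) _ = refl

  latestAt : ∀ σ k (k<m : k < m) {y} → Inc y (edgeAt σ k k<m) → LatestBelow σ y (suc k) (edgeAt σ k k<m)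
  latestAt σ k k<m i = latest i (subst (_< suc k) (sym pe) ≤-refl)
    λ f′ _ lt → subst (pos σ f′ ≤_) (sym pe) (≤-pred lt)
    where pe = pos-edgeAt σ k k<m

  otherThanAt : ∀ σ k (k<m : k < m) {y} → ¬ Inc y (edgeAt σ k k<m) → ∀ f → Inc y f → pos σ f ≢ k
  otherThanAt σ k k<m ¬i f i pf≡k =
    ¬i (subst (Inc _) (pos-injective σ (trans pf≡k (sym (pos-edgeAt σ k k<m)))) i)

  walk-prefix : ∀ σ k → k ≤ m → ∀ y → Walk σ y k (prefix σ k y)
  walk-prefix σ zero _ y = stop λ _ _ ()
  walk-prefix σ (suc k) k<m y
    rewrite transpositionAt-< σ k k<m with incident? y (edgeAt σ k k<m)
  ... | yes i = step e (latestAt σ k k<m i)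
                  (castWalk refl (sym (pos-edgeAt σ k k<m)) (walk-prefix σ k (<⇒≤ k<m) (sw e y)))
    where e = edgeAt σ k k<m
  ... | no ¬i rewrite sw-nonincident ¬i =
    widen (walk-prefix σ k (<⇒≤ k<m) y) (otherThanAt σ k k<m ¬i)

  walk-deterministic : ∀ {σ y k z z′} → Walk σ y k z → Walk σ y k z′ → z ≡ z′
  walk-deterministic (stop _) (stop _) = refl
  walk-deterministic (stop none) (step f l _) = ⊥-elim (none f (incident l) (below l))
  walk-deterministic (step f l _) (stop none) = ⊥-elim (none f (incident l) (below l))
  walk-deterministic (step f l w) (step f′ l′ w′) with latest-unique l l′
  ... | refl = walk-deterministic w w′

  walk-end : ∀ {σ y z} → Walk σ y m z → z ≡ c T σ y
  walk-end {σ} {y} w = trans (walk-deterministic w (walk-prefix σ m ≤-refl y)) (sym (c≐prefix σ y))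

  latest-or-none : ∀ {σ y k z} → Walk σ y k z → NoneBelow σ y k ⊎ ∃ (LatestBelow σ y k)
  latest-or-none (stop none) = inj₁ none
  latest-or-none (step f l _) = inj₂ (f , l)

  -- Local orders determine the product

  LocallyExtends : Ordering m → Ordering m → Set
  LocallyExtends τ σ = InL τ (LocalUnion T σ)

  module _ (σ τ : Ordering m) (ext : LocallyExtends τ σ) where

    extends-at : ∀ {i e f} → Inc i e → Inc i f → pos σ e < pos σ f → pos τ e < pos τ f
    extends-at ie if lt = ext _ _ (_ , ie , if , lt)

    LocallyExtends-sym : LocallyExtends σ τ
    LocallyExtends-sym e f (i , ie , if , lt) with <-cmp (pos σ e) (pos σ f)
    ... | tri< e<f _ _ = e<f
    ... | tri≈ _ e≡f _ = ⊥-elim (<-irrefl (cong (pos τ) (pos-injective σ e≡f)) lt)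
    ... | tri> _ _ f<e = ⊥-elim (<-asym lt (extends-at if ie f<e))

    extends-at-≤ : ∀ {i e f} → Inc i e → Inc i f → pos σ e ≤ pos σ f → pos τ e ≤ pos τ f
    extends-at-≤ ie if le with m≤n⇒m<n∨m≡n le
    ... | inj₁ lt = <⇒≤ (extends-at ie if lt)
    ... | inj₂ eq = ≤-reflexive (cong (pos τ) (pos-injective σ eq))

    SameEarlier : V → ℕ → ℕ → Set
    SameEarlier y kσ kτ = ∀ f → Inc y f → pos σ f < kσ ⇔ pos τ f < kτ

    walk-transfer : ∀ {y kσ kτ z} → SameEarlier y kσ kτ → Walk σ y kσ z → Walk τ y kτ z
    walk-transfer same (stop none) = stop λ f i lt → none f i (Equivalence.from (same f i) lt)
    walk-transfer {y} same (step f (latest i lt mx) w) =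
      step f (latest i (Equivalence.to (same f i) lt)
                     λ f′ i′ lt′ → extends-at-≤ i′ i (mx f′ i′ (Equivalence.from (same f′ i′) lt′)))
           (walk-transfer same′ w)
      where
      same′ : SameEarlier (sw f y) (pos σ f) (pos τ f)
      same′ f′ i′ = mk⇔ (extends-at i′ (sw-incident i))
                        (λ lt → LocallyExtends-sym _ _ (_ , i′ , sw-incident i , lt))

    extends⇒c≐ : c T σ ≐ c T τ
    extends⇒c≐ y = trans (c≐prefix σ y) (walk-end (walk-transfer all-earlier (walk-prefix σ m ≤-refl y)))
      where
      all-earlier : SameEarlier y m m
      all-earlier f _ = mk⇔ (λ _ → pos<m τ f) (λ _ → pos<m σ f)

    extends⇒p⊆ : ∀ {e f} → p T σ e f → p T τ e f
    extends⇒p⊆ = TransClosure-map λ (i , ie , if , lt) → i , ie , if , extends-at ie if lt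

  p⊆order : ∀ σ {e f} → p T σ e f → e <[ σ ] f
  p⊆order σ = Plus.transitive⁻ (λ e f → e <[ σ ] f) <-trans ∘ TransClosure-map λ (_ , _ , _ , lt) → lt

  ∈L⇒c≐ : ∀ σ τ → InL τ (p T σ) → c T σ ≐ c T τ
  ∈L⇒c≐ σ τ τ∈L = extends⇒c≐ σ τ λ e f → τ∈L e f ∘ [_]

  p≐ᵣ⇒c≐ : ∀ σ τ → p T σ ≐ᵣ p T τ → c T σ ≐ c T τ
  p≐ᵣ⇒c≐ σ τ p≐ = ∈L⇒c≐ σ τ λ e f → p⊆order τ ∘ proj₁ (p≐ e f)

  -- Bridges and trails in a tree

  -- label es x is a representative of the component of x in the subgraph with edge set es.
  relabel : (V → V) → V × V → V → V
  relabel L (u , v) w = if does (w ≟ L v) then L u else w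

  label : List (Fin m) → V → V
  label [] = id
  label (e ∷ es) = relabel (label es) (T e) ∘ label es

  ∣image∣≤1+∣image-relabel∣ : ∀ L q → ∣ image L ∣ ≤ suc ∣ image (relabel L q ∘ L) ∣
  ∣image∣≤1+∣image-relabel∣ L (u , v) = begin
    ∣ image L ∣                         ≤⟨ p⊆q⇒∣p∣≤∣q∣ image⊆ ⟩
    ∣ image L′ ∪ ⁅ L v ⁆ ∣              ≤⟨ ∣p∪q∣≤∣p∣+∣q∣ (image L′) ⁅ L v ⁆ ⟩
    ∣ image L′ ∣ + ∣ ⁅ L v ⁆ ∣          ≡⟨ cong (∣ image L′ ∣ +_) (∣⁅x⁆∣≡1 (L v)) ⟩
    ∣ image L′ ∣ + 1                    ≡⟨ +-comm ∣ image L′ ∣ 1 ⟩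
    suc ∣ image L′ ∣                    ∎
    where
    open ≤-Reasoning
    L′ = relabel L (u , v) ∘ L
    image⊆ : image L ⊆ image L′ ∪ ⁅ L v ⁆
    image⊆ y∈ with ∈-image⁻ L y∈
    ... | x , refl with L x ≟ L v
    ...   | yes Lx≡Lv = q⊆p∪q (image L′) _ (subst (_∈ₛ ⁅ L v ⁆) (sym Lx≡Lv) (x∈⁅x⁆ (L v)))
    ...   | no Lx≢Lv = p⊆p∪q ⁅ L v ⁆ (subst (_∈ₛ image L′) fixed (∈-image⁺ L′ x))
      where
      fixed : L′ x ≡ L x
      fixed with L x ≟ L v
      ... | yes Lx≡Lv = ⊥-elim (Lx≢Lv Lx≡Lv)
      ... | no _ = refl

  vertices≤components+edges : ∀ es → suc m ≤ ∣ image (label es) ∣ + length es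
  vertices≤components+edges [] = subst (suc m ≤_) (sym (+-identityʳ _)) (n≤∣image-id∣ (suc m))
  vertices≤components+edges (e ∷ es) = begin
    suc m                                           ≤⟨ vertices≤components+edges es ⟩
    ∣ image (label es) ∣ + length es                 ≤⟨ +-monoˡ-≤ (length es) (∣image∣≤1+∣image-relabel∣ (label es) (T e)) ⟩
    suc ∣ image (label (e ∷ es)) ∣ + length es       ≡⟨ sym (+-suc _ (length es)) ⟩
    ∣ image (label (e ∷ es)) ∣ + length (e ∷ es)     ∎
    where open ≤-Reasoning

  label-joins : ∀ {e es} → e ∈ es → label es (proj₁ (T e)) ≡ label es (proj₂ (T e))
  label-joins {e} {_ ∷ es} (here refl)
    with label es (proj₁ (T e)) ≟ label es (proj₂ (T e)) | label es (proj₂ (T e)) ≟ label es (proj₂ (T e))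
  ... | _ | no ¬refl = ⊥-elim (¬refl refl)
  ... | yes _ | yes _ = refl
  ... | no _ | yes _ = refl
  label-joins {es = e′ ∷ es} (there e∈) = cong (relabel (label es) (T e′)) (label-joins e∈)

  Avoiding : Fin m → V → V → Set
  Avoiding g u v = ∃ λ e → g ≢ e × (T e ≡ (u , v) ⊎ T e ≡ (v , u))

  Avoiding-sym : ∀ {g u v} → Avoiding g u v → Avoiding g v u
  Avoiding-sym (e , g≢e , inj₁ eq) = e , g≢e , inj₂ eq
  Avoiding-sym (e , g≢e , inj₂ eq) = e , g≢e , inj₁ eq

  along : ∀ (L : V → V) {e u v} → L (proj₁ (T e)) ≡ L (proj₂ (T e)) →
          T e ≡ (u , v) ⊎ T e ≡ (v , u) → L u ≡ L v
  along L eq (inj₁ ends) = subst (λ t → L (proj₁ t) ≡ L (proj₂ t)) ends eq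
  along L eq (inj₂ ends) = sym (subst (λ t → L (proj₁ t) ≡ L (proj₂ t)) ends eq)

  data Path : V → V → List (Fin m) → Set where
    nil  : ∀ {x} → Path x x []
    cons : ∀ {x z es} f → Inc x f → Path (sw f x) z es → Path x z (f ∷ es)

  path-avoiding : ∀ {g x z es} → Path x z es → All (g ≢_) es → Star (Avoiding g) x z
  path-avoiding nil [] = ε
  path-avoiding (cons f i p) (g≢f ∷ g∉) = (f , g≢f , incident-ends i) ◅ path-avoiding p g∉

  split-at-first : ∀ {a z r g} → Path a z r → g ∈ r →
                   ∃₂ λ w A → Inc w g × A List.⊆ r × All (g ≢_) A × Path a w A
  split-at-first {a} {g = g} (cons f i p) g∈ with f ≟ g
  ... | yes refl = a , [] , i , (λ ()) , [] , nil
  split-at-first (cons f i p) (here g≡f) | no f≢g = ⊥-elim (f≢g (sym g≡f))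
  split-at-first (cons f i p) (there g∈) | no f≢g with split-at-first p g∈
  ... | w , A , iw , A⊆ , g∉A , pA =
    w , f ∷ A , iw , (λ { (here refl) → here refl ; (there e∈) → there (A⊆ e∈) }) ,
    ≢-sym f≢g ∷ g∉A , cons f i pA

  module _ (tree : IsTree T) where

    -- Otherwise the m - 1 edges other than g would still connect all m + 1 vertices.
    bridge : ∀ g → ¬ Star (Avoiding g) (proj₁ (T g)) (proj₂ (T g))
    bridge g detour = <-irrefl refl (begin-strict
      suc m                          ≤⟨ vertices≤components+edges others ⟩
      ∣ image L ∣ + length others    ≤⟨ +-monoˡ-≤ (length others) (∣image∣≤1 L constant fz) ⟩
      suc (length others)            <⟨ s≤s fewer ⟩
      suc m                          ∎)
      where
      open ≤-Reasoning
      others = filter (λ e → ¬? (g ≟ e)) (allFin m)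
      L = label others

      along-other : ∀ {e u v} → g ≢ e → T e ≡ (u , v) ⊎ T e ≡ (v , u) → L u ≡ L v
      along-other {e} g≢e = along L (label-joins (∈-filter⁺ (λ e → ¬? (g ≟ e)) (∈-allFin e) g≢e))

      g-joins : L (proj₁ (T g)) ≡ L (proj₂ (T g))
      g-joins = Star.fold (λ u v → L u ≡ L v) (λ (_ , g≢e , ends) eq → trans (along-other g≢e ends) eq) refl detour

      joins : ∀ {u v} → Adjacent T u v → L u ≡ L v
      joins (e , ends) with g ≟ e
      ... | yes refl = along L g-joins ends
      ... | no g≢e = along-other g≢e ends

      constant : ∀ x x′ → L x ≡ L x′
      constant x x′ = Star.fold (λ u v → L u ≡ L v) (λ a eq → trans (joins a) eq) refl (IsTree.connected tree x x′)

      fewer : length others < m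
      fewer = subst (length others <_) (length-tabulate id)
        (filter-notAll (λ e → ¬? (g ≟ e)) (allFin m) (Any.map (λ g≡e g≢e → g≢e g≡e) (∈-allFin g)))

    bridge-from : ∀ {x g} → Inc x g → ¬ Star (Avoiding g) (sw g x) x
    bridge-from {x} {g} i detour with incident-ends i
    ... | inj₁ ends = bridge g (subst (λ t → Star (Avoiding g) (proj₁ t) (proj₂ t)) (sym ends)
                                      (Star.reverse Avoiding-sym detour))
    ... | inj₂ ends = bridge g (subst (λ t → Star (Avoiding g) (proj₁ t) (proj₂ t)) (sym ends) detour)

    trail-unique : ∀ {x z es₁ es₂} → Path x z es₁ → Unique es₁ → Path x z es₂ → Unique es₂ → es₁ ≡ es₂
    trail-unique nil _ nil _ = refl
    trail-unique nil _ (cons h ih p) (h∉ ∷ _) = ⊥-elim (bridge-from ih (path-avoiding p h∉))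
    trail-unique (cons g ig p) (g∉ ∷ _) nil _ = ⊥-elim (bridge-from ig (path-avoiding p g∉))
    trail-unique {x} (cons g ig p₁) (g∉₁ ∷ u₁) (cons h ih p₂) (h∉₂ ∷ u₂) with g ≟ h
    ... | yes refl = cong (g ∷_) (trail-unique p₁ u₁ p₂ u₂)
    ... | no g≢h with Any.any? (g ≟_) _
    ...   | no g∉₂ = ⊥-elim (bridge-from ig (path-avoiding p₁ g∉₁ ◅◅ Star.reverse Avoiding-sym
                                          (path-avoiding (cons h ih p₂) (g≢h ∷ ¬Any⇒All¬ _ g∉₂))))
    ...   | yes g∈₂ with split-at-first p₂ g∈₂
    ...     | w , A , iw , A⊆ , g∉A , pA with incident-endpoints ig iw
    ...       | inj₁ refl = ⊥-elim (bridge-from ih (path-avoiding pA (anti-mono A⊆ h∉₂)))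
    ...       | inj₂ refl = ⊥-elim (bridge-from ig (Star.reverse Avoiding-sym
                                     ((h , g≢h , incident-ends ih) ◅ path-avoiding pA g∉A)))

  -- The product determines the local orders

  walk-path : ∀ {σ y k z} (w : Walk σ y k z) → Path y z (edges w)
  walk-path (stop _) = nil
  walk-path (step f l w) = cons f (incident l) (walk-path w)

  walk-edges-below : ∀ {σ y k z} (w : Walk σ y k z) → All (λ e → pos σ e < k) (edges w)
  walk-edges-below (stop _) = []
  walk-edges-below (step f l w) = below l ∷ All.map (λ e<f → <-trans e<f (below l)) (walk-edges-below w)

  walk-edges-unique : ∀ {σ y k z} (w : Walk σ y k z) → Unique (edges w)
  walk-edges-unique {σ} (step f l w) =
    All.map (λ e<f f≡e → <-irrefl (cong (pos σ) (sym f≡e)) e<f) (walk-edges-below w) ∷ walk-edges-unique w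
  walk-edges-unique (stop _) = []

  extend-walk-by-one : ∀ {σ y j z} (w : Walk σ y j z) → j < m →
                       ∃₂ λ y′ ps → Σ (Walk σ y′ (suc j) z) λ w′ → edges w′ ≡ ps ++ edges w
  extend-walk-by-one {σ} {y} {j} w j<m with incident? y (edgeAt σ j j<m)
  ... | yes i = sw e y , e ∷ [] , step e (latestAt σ j j<m (sw-incident i)) w′ ,
                cong (e ∷_) (castWalk-edges _ _ w)
    where
    e = edgeAt σ j j<m
    w′ = castWalk (sym (sw-involutive e y)) (sym (pos-edgeAt σ j j<m)) w
  ... | no ¬i = y , [] , widen w (otherThanAt σ j j<m ¬i) , widen-edges w _

  extend-walk : ∀ {σ y j k z} → j ≤′ k → k ≤ m → (w : Walk σ y j z) →
                ∃₂ λ y′ ps → Σ (Walk σ y′ k z) λ w′ → edges w′ ≡ ps ++ edges w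
  extend-walk ≤′-refl _ w = _ , [] , w , refl
  extend-walk (≤′-step j≤k) k<m w with extend-walk j≤k (<⇒≤ k<m) w
  ... | _ , ps , w′ , eq with extend-walk-by-one w′ k<m
  ...   | y″ , qs , w″ , eq′ =
    y″ , qs ++ ps , w″ , trans eq′ (trans (cong (qs ++_) eq) (sym (++-assoc qs ps (edges w))))

  consecutive-on-walk : ∀ σ {i f g} → Inc i f → LatestBelow σ i (pos σ f) g →
                        ∃₂ λ x z → Σ (Walk σ x m z) λ w → Infix _≡_ (f ∷ g ∷ []) (edges w)
  consecutive-on-walk σ {i} {f} {g} if l with extend-walk (≤⇒≤′ (pos<m σ f)) ≤-refl w₀
    where
    l′ : LatestBelow σ (sw f (sw f i)) (pos σ f) g
    l′ = subst (λ v → LatestBelow σ v (pos σ f) g) (sym (sw-involutive f i)) l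
    w₀ = step f (latest (sw-incident if) ≤-refl (λ _ _ → ≤-pred))
                (step g l′ (walk-prefix σ (pos σ g) (<⇒≤ (pos<m σ g)) _))
  ... | x , ps , w , eq = x , _ , w , subst (Infix _≡_ _) (sym eq) (ps ++ⁱ here (refl ∷ refl ∷ []))

  consecutive-descending : ∀ {σ y k z f g} (w : Walk σ y k z) →
                           Infix _≡_ (f ∷ g ∷ []) (edges w) → pos σ g < pos σ f
  consecutive-descending (step _ _ (step _ l _)) (here (refl ∷ refl ∷ [])) = below l
  consecutive-descending (step _ _ w) (there fg) = consecutive-descending w fg
  consecutive-descending (stop _) (here ())
  consecutive-descending (step _ _ (stop _)) (here (_ ∷ ()))

  module _ (σ τ : Ordering m) where

    extends-from-latest : (∀ {i f g} → Inc i f → LatestBelow σ i (pos σ f) g → pos τ g < pos τ f) →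
                          LocallyExtends τ σ
    extends-from-latest latest-kept e f (i , ie , if , e<f) = earlier m (pos<m σ f) ie if e<f
      where
      earlier : ∀ fuel {e f} → pos σ f < fuel → Inc i e → Inc i f → pos σ e < pos σ f → pos τ e < pos τ f
      earlier (suc fuel) {e} {f} f<fuel ie if e<f
        with latest-or-none (walk-prefix σ (pos σ f) (<⇒≤ (pos<m σ f)) i)
      ... | inj₁ none = ⊥-elim (none e ie e<f)
      ... | inj₂ (g , l) with m≤n⇒m<n∨m≡n (maximal l e ie e<f)
      ...   | inj₂ e≡g = subst (λ e′ → pos τ e′ < pos τ f) (sym (pos-injective σ e≡g)) (latest-kept if l)
      ...   | inj₁ e<g = <-trans (earlier fuel (<-≤-trans (below l) (≤-pred f<fuel)) ie (incident l) e<g)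
                                 (latest-kept if l)

  module _ (tree : IsTree T) where

    full-walks-agree : ∀ {σ τ x z z′} → c T σ ≐ c T τ → (w : Walk σ x m z) (w′ : Walk τ x m z′) →
                       edges w ≡ edges w′
    full-walks-agree {x = x} ceq w w′ =
      trail-unique tree (subst (λ v → Path x v (edges w)) same-end (walk-path w)) (walk-edges-unique w)
                   (walk-path w′) (walk-edges-unique w′)
      where
      same-end = trans (walk-end w) (trans (ceq x) (sym (walk-end w′)))

    latest-preserved : ∀ σ τ → c T σ ≐ c T τ →
                       ∀ {i f g} → Inc i f → LatestBelow σ i (pos σ f) g → pos τ g < pos τ f
    latest-preserved σ τ ceq if l with consecutive-on-walk σ if l
    ... | x , _ , w , fg = consecutive-descending wτ (subst (Infix _≡_ _) (full-walks-agree ceq w wτ) fg)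
      where wτ = walk-prefix τ m ≤-refl x

    c≐⇒extends : ∀ σ τ → c T σ ≐ c T τ → LocallyExtends τ σ
    c≐⇒extends σ τ ceq = extends-from-latest σ τ (latest-preserved σ τ ceq)

    c≐⇒∈L : ∀ σ τ → c T σ ≐ c T τ → InL τ (p T σ)
    c≐⇒∈L σ τ c≐ e f = p⊆order τ ∘ extends⇒p⊆ σ τ (c≐⇒extends σ τ c≐)

    c≐⇒p≐ᵣ : ∀ σ τ → c T σ ≐ c T τ → p T σ ≐ᵣ p T τ
    c≐⇒p≐ᵣ σ τ c≐ e f = extends⇒p⊆ σ τ (c≐⇒extends σ τ c≐) , extends⇒p⊆ τ σ (c≐⇒extends τ σ (sym ∘ c≐))

theorem3p1 : ∀ {m} (T : EdgeList (suc m) m) → IsTree T →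
    -- c_σ ↦ p_σ is well defined (and injective), hence a bijection C(T) → P(T)
    (∀ σ τ → (c T σ ≐ c T τ → p T σ ≐ᵣ p T τ) × (p T σ ≐ᵣ p T τ → c T σ ≐ c T τ))
    ×
    -- {τ ∈ O(T) : c_τ = c_σ} = L(p_σ)
    (∀ σ τ → (c T τ ≐ c T σ → InL τ (p T σ)) × (InL τ (p T σ) → c T τ ≐ c T σ))
theorem3p1 T tree =
  (λ σ τ → c≐⇒p≐ᵣ T tree σ τ , p≐ᵣ⇒c≐ T σ τ) ,
  (λ σ τ → (λ c≐ → c≐⇒∈L T tree σ τ (sym ∘ c≐)) , (λ τ∈L → sym ∘ ∈L⇒c≐ T σ τ τ∈L))
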